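{- Let $k\ge 1$ and $n\ge 2$ be integers. Then \[ \gamma_{[k]R}(C_{9}\Box P_n) \le 2n(k+1) + 2k. \]
   Context: All graphs are finite and simple. For a vertex $v$ of a graph $G$, $N(v)$ denotes its open neighborhood and $N[v]=N(v)\cup\{v\}$ its closed neighborhood. For $f:V(G)\to\mathbb{N}_0$ and $S\subseteq V(G)$ write $f(S)=\sum_{u\in S}f(u)$. For a positive integer $k$, a $[k]$-Roman dominating function of $G$ is a function $f:V(G)\to\{0,1,\dots,k+1\}$ such that every vertex $v$ with $f(v)<k$ satisfies $f(N[v])\ge k+|AN(v)|$, where $AN(v)=\{u\in N(v): f(u)>0\}$. The $[k]$-Roman domination number $\gamma_{[k]R}(G)$ is the minimum of $f(V(G))$ over all $[k]$-Roman dominating functions $f$ of $G$. $C_m\Box P_n$ denotes the Cartesian product of the cycle $C_m$ ($m\ge3$) and the path $P_n$ on $n$ vertices: its vertices are pairs $(i,j)$ with $i\in\{0,\dots,m-1\}$, $j\in\{0,\dots,n-1\}$, and $(i,j)$ is adjacent to $(i',j')$ iff either $j=j'$ and $i-i'\equiv\pm1\pmod m$, or $i=i'$ and $|j-j'|=1$. -}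

module Defs where

open import Data.Nat using (ℕ; suc; _+_; _≤_; _<_; _≡ᵇ_; _<ᵇ_)
open import Data.Nat.Properties using ()
open import Data.Bool using (Bool; true; false; _∧_; _∨_; if_then_else_)
open import Data.Fin using (Fin; toℕ)
open import Data.Nat.ListAction using (sum)
open import Data.List using (List; map; filter; length; allFin; cartesianProduct)
open import Data.Product using (_×_; _,_; Σ-syntax)
open import Relation.Binary.PropositionalEquality using (_≡_)

-- A finite simple graph given by an explicit list of its vertices
-- (each vertex occurring exactly once) and a Boolean adjacency relation
-- that is symmetric and irreflexive.  (Only the concrete graph C_m □ P_n
-- is used below; its list/adjacency are defined explicitly.)
record FinGraph : Set₁ where
  field
    V     : Set
    verts : List V
    adj   : V → V → Bool

open FinGraph public

fN : (G : FinGraph) → (V G → ℕ) → V G → ℕ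
fN G f v = sum (map (λ u → if adj G v u then f u else 0) (verts G))

-- f(N[v]) = f(v) + f(N(v))   (adjacency is irreflexive)
fNcl : (G : FinGraph) → (V G → ℕ) → V G → ℕ
fNcl G f v = f v + fN G f v

AN-size : (G : FinGraph) → (V G → ℕ) → V G → ℕ
AN-size G f v = sum (map (λ u → if adj G v u ∧ (0 <ᵇ f u) then 1 else 0) (verts G))

weight : (G : FinGraph) → (V G → ℕ) → ℕ
weight G f = sum (map f (verts G))

record IsKRDF (k : ℕ) (G : FinGraph) (f : V G → ℕ) : Set where
  field
    range : ∀ v → f v ≤ suc k
    cond  : ∀ v → f v < k → k + AN-size G f v ≤ fNcl G f v

-- γ_[k]R(G) ≤ b  :⇔  some [k]-RDF of G has weight ≤ b
-- (γ_[k]R is the minimum weight of a [k]-RDF, which always exists since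
-- the constant function k+1 is one).
γ[_]R≤ : ℕ → FinGraph → ℕ → Set
γ[ k ]R≤ G b = Σ[ f ∈ (V G → ℕ) ] (IsKRDF k G f × weight G f ≤ b)

cycAdj : (m : ℕ) → Fin m → Fin m → Bool
cycAdj m i i' = (suc (toℕ i) ≡ᵇ toℕ i') ∨ (suc (toℕ i') ≡ᵇ toℕ i)
              ∨ ((toℕ i ≡ᵇ 0) ∧ (suc (toℕ i') ≡ᵇ m))
              ∨ ((toℕ i' ≡ᵇ 0) ∧ (suc (toℕ i) ≡ᵇ m))

pathAdj : (n : ℕ) → Fin n → Fin n → Bool
pathAdj n j j' = (suc (toℕ j) ≡ᵇ toℕ j') ∨ (suc (toℕ j') ≡ᵇ toℕ j)

CP : ℕ → ℕ → FinGraph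
CP m n = record
  { V     = Fin m × Fin n
  ; verts = cartesianProduct (allFin m) (allFin n)
  ; adj   = λ { (i , j) (i' , j') →
               ((toℕ j ≡ᵇ toℕ j') ∧ cycAdj m i i') ∨ ((toℕ i ≡ᵇ toℕ i') ∧ pathAdj n j j') }
  }

{-# OPTIONS --safe #-}
module Submission where

-- Call a cell strong (value k + 1), weak (value k) or empty (value 0).  If every empty vertex
-- has a strong neighbour, the resulting function is a [k]-Roman dominating function: that
-- neighbour alone contributes k + 1 to f(N[v]), every other active neighbour at least 1.
-- In C₉ □ Pₙ every row gets two strong cells, arranged with period 5 down the rows so that
-- each cell of an inner row is dominated within its row or from the rows above and below.
-- Cells left undominated are made weak; starting the pattern in the right phase (which depends
-- on n mod 5) leaves exactly one of them in the top row and one in the bottom row, for a total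
-- weight of 2n(k + 1) + 2k.

open import Defs
open import Data.Nat using (ℕ; zero; suc; _+_; _*_; _≤_; _<_; _≡ᵇ_; _<ᵇ_; s≤s; s≤s⁻¹; z≤n)
open import Data.Nat.Properties
  using (≤-refl; ≤-reflexive; ≤-trans; <⇒≤; 1+n≰n; n≮n; ≤∧≢⇒<; n≤1+n; m≤n+m; +-mono-≤; +-comm;
         +-assoc; ≡ᵇ⇒≡; ≡⇒≡ᵇ; +-commutativeSemigroup; +-0-commutativeMonoid)
open import Data.Nat.ListAction using (sum)
open import Data.Nat.ListAction.Properties using (sum-++)
open import Data.Nat.Tactic.RingSolver using (solve-∀)
open import Data.Bool using (Bool; true; false; T; _∧_; _∨_; if_then_else_)
open import Data.Bool.Properties using (T-∧; T-∨; T-≡; T?; if-float)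
open import Data.Fin as Fin using (Fin; toℕ; fromℕ<; inject₁)
open import Data.Fin.Properties using (any?; toℕ<n; toℕ-fromℕ<; toℕ-inject₁)
open import Data.List using ([]; _∷_; _++_; map; allFin; tabulate; cartesianProduct)
open import Data.List.Properties using (map-++; map-∘; map-cong; map-tabulate)
open import Data.List.Membership.Propositional using (_∈_)
open import Data.List.Membership.Propositional.Properties using (∈-cartesianProduct⁺; ∈-allFin)
open import Data.List.Relation.Unary.Any using (here; there)
open import Data.Product using (∃-syntax; _×_; _,_; proj₁; proj₂)
open import Data.Sum using (_⊎_; inj₁; inj₂)
open import Function using (_∘_; id; Equivalence)
open import Relation.Nullary using (Dec; yes; no; does; contradiction)
open import Relation.Nullary.Decidable using (_⊎-dec_; _×-dec_)
open import Relation.Binary.PropositionalEquality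
open import Algebra.Properties.CommutativeSemigroup +-commutativeSemigroup using (x∙yz≈y∙xz)
open import Algebra.Properties.CommutativeMonoid.Sum +-0-commutativeMonoid
  using (sum-syntax; sum-cong-≗; ∑-comm) renaming (sum to ∑)

open Equivalence using (to; from)

data Label : Set where
  strong weak empty : Label

value : ℕ → Label → ℕ
value k strong = suc k
value k weak   = k
value k empty  = 0

#strong #weak : Label → ℕ
#strong strong = 1
#strong _      = 0
#weak weak = 1
#weak _    = 0

value<k⇒empty : ∀ {k} l → value k l < k → l ≡ empty
value<k⇒empty     strong lt = contradiction (<⇒≤ lt) 1+n≰n
value<k⇒empty {k} weak   lt = contradiction lt (n≮n k)
value<k⇒empty     empty  _  = refl

sum-map-mono : ∀ {A : Set} {g h : A → ℕ} → (∀ a → h a ≤ g a) →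
               ∀ xs → sum (map h xs) ≤ sum (map g xs)
sum-map-mono h≤g []       = z≤n
sum-map-mono h≤g (x ∷ xs) = +-mono-≤ (h≤g x) (sum-map-mono h≤g xs)

sum-map-mono-gap : ∀ {A : Set} {g h : A → ℕ} {c u} → (∀ a → h a ≤ g a) → c + h u ≤ g u →
                   ∀ {xs} → u ∈ xs → c + sum (map h xs) ≤ sum (map g xs)
sum-map-mono-gap {h = h} {c = c} {u} h≤g gap {_ ∷ xs} (here refl) =
  ≤-trans (≤-reflexive (sym (+-assoc c (h u) _))) (+-mono-≤ gap (sum-map-mono h≤g xs))
sum-map-mono-gap {h = h} {c = c} h≤g gap {x ∷ _} (there u∈xs) =
  ≤-trans (≤-reflexive (x∙yz≈y∙xz c (h x) _)) (+-mono-≤ (h≤g x) (sum-map-mono-gap h≤g gap u∈xs))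

sum-map-value : ∀ {A : Set} k (ℓ : A → Label) xs →
  sum (map (value k ∘ ℓ) xs) ≡ sum (map (#strong ∘ ℓ) xs) * suc k + sum (map (#weak ∘ ℓ) xs) * k
sum-map-value k ℓ []       = refl
sum-map-value k ℓ (x ∷ xs) with ℓ x
... | strong = trans (cong (suc k +_) (sum-map-value k ℓ xs)) (sym (+-assoc (suc k) _ _))
... | weak   = trans (cong (k +_) (sum-map-value k ℓ xs))
                     (x∙yz≈y∙xz k (sum (map (#strong ∘ ℓ) xs) * suc k) _)
... | empty  = sum-map-value k ℓ xs

active≤weight : ∀ b m → (if b ∧ (0 <ᵇ m) then 1 else 0) ≤ (if b then m else 0)
active≤weight true  zero    = z≤n
active≤weight true  (suc m) = s≤s z≤n
active≤weight false m       = z≤n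

StrongNeighbour : (G : FinGraph) → (V G → Label) → V G → Set
StrongNeighbour G ℓ v = ∃[ u ] (u ∈ verts G × T (adj G v u) × ℓ u ≡ strong)

module _ {k : ℕ} {G : FinGraph} (ℓ : V G → Label) where

  private
    f : V G → ℕ
    f = value k ∘ ℓ

  strongNeighbour⇒AN-size≤fN : ∀ {v u} → u ∈ verts G → T (adj G v u) → ℓ u ≡ strong →
                               k + AN-size G f v ≤ fN G f v
  strongNeighbour⇒AN-size≤fN {v} {u} u∈G vu ℓu =
    sum-map-mono-gap (λ w → active≤weight (adj G v w) (f w)) gap u∈G
    where
    gap : k + (if adj G v u ∧ (0 <ᵇ f u) then 1 else 0) ≤ (if adj G v u then f u else 0)
    gap rewrite to T-≡ vu | ℓu = ≤-reflexive (+-comm k 1)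

  isKRDF-value : (∀ v → ℓ v ≡ empty → StrongNeighbour G ℓ v) → IsKRDF k G f
  isKRDF-value dominated = record { range = range ; cond = cond }
    where
    range : ∀ v → f v ≤ suc k
    range v with ℓ v
    ... | strong = ≤-refl
    ... | weak   = n≤1+n k
    ... | empty  = z≤n
    cond : ∀ v → f v < k → k + AN-size G f v ≤ fNcl G f v
    cond v lt with dominated v (value<k⇒empty (ℓ v) lt)
    ... | u , u∈G , vu , ℓu = ≤-trans (strongNeighbour⇒AN-size≤fN u∈G vu ℓu) (m≤n+m _ (f v))

sum-map-cartesianProduct : ∀ {A B : Set} (F : A × B → ℕ) xs ys →
  sum (map F (cartesianProduct xs ys)) ≡ sum (map (λ x → sum (map (λ y → F (x , y)) ys)) xs)
sum-map-cartesianProduct F []       ys = refl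
sum-map-cartesianProduct F (x ∷ xs) ys = begin
  sum (map F (map (x ,_) ys ++ cartesianProduct xs ys))
    ≡⟨ cong sum (map-++ F (map (x ,_) ys) _) ⟩
  sum (map F (map (x ,_) ys) ++ map F (cartesianProduct xs ys))
    ≡⟨ sum-++ (map F (map (x ,_) ys)) _ ⟩
  sum (map F (map (x ,_) ys)) + sum (map F (cartesianProduct xs ys))
    ≡⟨ cong₂ _+_ (cong sum (sym (map-∘ ys))) (sum-map-cartesianProduct F xs ys) ⟩
  sum (map (λ y → F (x , y)) ys) + sum (map (λ x → sum (map (λ y → F (x , y)) ys)) xs) ∎
  where open ≡-Reasoning

sum-tabulate : ∀ {n} (g : Fin n → ℕ) → sum (tabulate g) ≡ ∑[ i < n ] g i
sum-tabulate {zero}  g = refl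
sum-tabulate {suc n} g = cong (g Fin.zero +_) (sum-tabulate (g ∘ Fin.suc))

sum-map-allFin : ∀ {n} (g : Fin n → ℕ) → sum (map g (allFin n)) ≡ ∑[ i < n ] g i
sum-map-allFin g = trans (cong sum (map-tabulate id g)) (sum-tabulate g)

sum-map-grid : ∀ {m n} (F : Fin m × Fin n → ℕ) →
  sum (map F (cartesianProduct (allFin m) (allFin n))) ≡ ∑[ j < n ] ∑[ i < m ] F (i , j)
sum-map-grid {m} {n} F = begin
  sum (map F (cartesianProduct (allFin m) (allFin n)))
    ≡⟨ sum-map-cartesianProduct F (allFin m) (allFin n) ⟩
  sum (map (λ i → sum (map (λ j → F (i , j)) (allFin n))) (allFin m))
    ≡⟨ cong sum (map-cong (λ i → sum-map-allFin (λ j → F (i , j))) (allFin m)) ⟩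
  sum (map (λ i → ∑[ j < n ] F (i , j)) (allFin m))
    ≡⟨ sum-map-allFin (λ i → ∑[ j < n ] F (i , j)) ⟩
  ∑[ i < m ] ∑[ j < n ] F (i , j)
    ≡⟨ ∑-comm (λ i j → F (i , j)) ⟩
  ∑[ j < n ] ∑[ i < m ] F (i , j) ∎
  where open ≡-Reasoning

∑-const : ∀ n c → ∑[ j < n ] c ≡ n * c
∑-const zero    c = refl
∑-const (suc n) c = cong (c +_) (∑-const n c)

∑-indicator-last : ∀ m → ∑[ j < suc m ] (if toℕ j ≡ᵇ m then 1 else 0) ≡ 1
∑-indicator-last zero    = refl
∑-indicator-last (suc m) = ∑-indicator-last m

data Phase : Set where
  φ₀ φ₁ φ₂ φ₃ φ₄ : Phase

next prev : Phase → Phase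
next φ₀ = φ₁
next φ₁ = φ₂
next φ₂ = φ₃
next φ₃ = φ₄
next φ₄ = φ₀
prev φ₀ = φ₄
prev φ₁ = φ₀
prev φ₂ = φ₁
prev φ₃ = φ₂
prev φ₄ = φ₃

prev-next : ∀ p → prev (next p) ≡ p
prev-next φ₀ = refl
prev-next φ₁ = refl
prev-next φ₂ = refl
prev-next φ₃ = refl
prev-next φ₄ = refl

next⁵ : ∀ p → next (next (next (next (next p)))) ≡ p
next⁵ φ₀ = refl
next⁵ φ₁ = refl
next⁵ φ₂ = refl
next⁵ φ₃ = refl
next⁵ φ₄ = refl

shift : Phase → ℕ → Phase
shift p zero    = p
shift p (suc x) = next (shift p x)

-- The two strong columns of a row are a and a + 5 (mod 9), and a moves by 2 (mod 5) from one
-- phase to the next; the three cells a row leaves undominated are then strong in the rows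
-- directly above and below it.
strongColumns : Phase → ℕ × ℕ
strongColumns φ₀ = 4 , 0
strongColumns φ₁ = 1 , 6
strongColumns φ₂ = 3 , 8
strongColumns φ₃ = 0 , 5
strongColumns φ₄ = 2 , 7

strongCell : Phase → Fin 9 → Bool
strongCell p i = (toℕ i ≡ᵇ proj₁ (strongColumns p)) ∨ (toℕ i ≡ᵇ proj₂ (strongColumns p))

data RowPos : Set where
  top middle bottom : RowPos

hasAbove hasBelow : RowPos → Bool
hasAbove top = false
hasAbove _   = true
hasBelow bottom = false
hasBelow _      = true

boundary : RowPos → ℕ
boundary middle = 0
boundary _      = 1

Dominated : RowPos → Phase → Fin 9 → Set
Dominated pos p i = (∃[ i′ ] (T (cycAdj 9 i i′) × T (strongCell p i′)))
                  ⊎ (T (hasAbove pos) × T (strongCell (prev p) i))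
                  ⊎ (T (hasBelow pos) × T (strongCell (next p) i))

dominated? : ∀ pos p i → Dec (Dominated pos p i)
dominated? pos p i = any? (λ i′ → T? _ ×-dec T? _) ⊎-dec (T? _ ×-dec T? _) ⊎-dec (T? _ ×-dec T? _)

labelCell : ∀ {A : Set} → Bool → Dec A → Label
labelCell s d = if s then strong else if does d then empty else weak

labelCell-strong : ∀ {A : Set} {s} (d : Dec A) → T s → labelCell s d ≡ strong
labelCell-strong {s = true} _ _ = refl

labelCell-empty : ∀ {A : Set} s (d : Dec A) → labelCell s d ≡ empty → A
labelCell-empty false (yes a) _ = a
labelCell-empty true  _       ()
labelCell-empty false (no _)  ()

#strong-labelCell : ∀ {A : Set} s (d : Dec A) → #strong (labelCell s d) ≡ (if s then 1 else 0)
#strong-labelCell true  _       = refl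
#strong-labelCell false (yes _) = refl
#strong-labelCell false (no _)  = refl

cellLabel : RowPos → Phase → Fin 9 → Label
cellLabel pos p i = labelCell (strongCell p i) (dominated? pos p i)

strongCellCount : ∀ p → ∑[ i < 9 ] (if strongCell p i then 1 else 0) ≡ 2
strongCellCount φ₀ = refl
strongCellCount φ₁ = refl
strongCellCount φ₂ = refl
strongCellCount φ₃ = refl
strongCellCount φ₄ = refl

strongInRow : ∀ pos p → ∑[ i < 9 ] #strong (cellLabel pos p i) ≡ 2
strongInRow pos p =
  trans (sum-cong-≗ (λ i → #strong-labelCell (strongCell p i) (dominated? pos p i))) (strongCellCount p)

undominatedInRow : RowPos → Phase → ℕ
undominatedInRow pos p = ∑[ i < 9 ] #weak (cellLabel pos p i)

undominated-middle : ∀ p → undominatedInRow middle p ≡ 0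
undominated-middle φ₀ = refl
undominated-middle φ₁ = refl
undominated-middle φ₂ = refl
undominated-middle φ₃ = refl
undominated-middle φ₄ = refl

topPhase : ℕ → Phase
topPhase 0 = φ₄
topPhase 1 = φ₁
topPhase 2 = φ₃
topPhase 3 = φ₁
topPhase 4 = φ₁
topPhase (suc (suc (suc (suc (suc d))))) = topPhase d

undominated-top : ∀ d → undominatedInRow top (topPhase d) ≡ 1
undominated-top 0 = refl
undominated-top 1 = refl
undominated-top 2 = refl
undominated-top 3 = refl
undominated-top 4 = refl
undominated-top (suc (suc (suc (suc (suc d))))) = undominated-top d

undominated-bottom : ∀ d → undominatedInRow bottom (shift (topPhase d) d) ≡ 1
undominated-bottom 0 = refl
undominated-bottom 1 = refl
undominated-bottom 2 = refl
undominated-bottom 3 = refl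
undominated-bottom 4 = refl
undominated-bottom (suc (suc (suc (suc (suc d))))) =
  trans (cong (undominatedInRow bottom) (next⁵ (shift (topPhase d) d))) (undominated-bottom d)

∈-grid : ∀ {m n} (v : Fin m × Fin n) → v ∈ verts (CP m n)
∈-grid (i , j) = ∈-cartesianProduct⁺ (∈-allFin i) (∈-allFin j)

adj-row : ∀ {m n} (i i′ : Fin m) (j : Fin n) → T (cycAdj m i i′) →
          T (adj (CP m n) (i , j) (i′ , j))
adj-row i i′ j ii′ = from T-∨ (inj₁ (from T-∧ (≡⇒≡ᵇ (toℕ j) (toℕ j) refl , ii′)))

adj-column : ∀ {m n} (i : Fin m) (j j′ : Fin n) → T (pathAdj n j j′) →
             T (adj (CP m n) (i , j) (i , j′))
adj-column i j j′ jj′ = from T-∨ (inj₂ (from T-∧ (≡⇒≡ᵇ (toℕ i) (toℕ i) refl , jj′)))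

pathAdj-suc : ∀ {n} (j j′ : Fin n) → toℕ j′ ≡ suc (toℕ j) → T (pathAdj n j j′)
pathAdj-suc j j′ e = from T-∨ (inj₁ (≡⇒≡ᵇ _ _ (sym e)))

pathAdj-pred : ∀ {n} (j j′ : Fin n) → toℕ j ≡ suc (toℕ j′) → T (pathAdj n j j′)
pathAdj-pred j j′ e = from T-∨ (inj₂ (≡⇒≡ᵇ _ _ (sym e)))

module Grid (m : ℕ) where

  grid : FinGraph
  grid = CP 9 (suc (suc m))

  rowPos : ℕ → RowPos
  rowPos zero = top
  rowPos (suc x) = if x ≡ᵇ m then bottom else middle

  phase : ℕ → Phase
  phase = shift (topPhase (suc m))

  label : Fin 9 × Fin (suc (suc m)) → Label
  label (i , j) = cellLabel (rowPos (toℕ j)) (phase (toℕ j)) i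

  hasBelow⇒suc< : ∀ x → x < suc (suc m) → T (hasBelow (rowPos x)) → suc x < suc (suc m)
  hasBelow⇒suc< zero    _  _ = s≤s (s≤s z≤n)
  hasBelow⇒suc< (suc x) lt _ with x ≡ᵇ m in x≠m
  ... | false = s≤s (s≤s (≤∧≢⇒< (s≤s⁻¹ (s≤s⁻¹ lt)) (subst T x≠m ∘ ≡⇒≡ᵇ x m)))

  label-strong : ∀ i j {x} → toℕ j ≡ x → T (strongCell (phase x) i) → label (i , j) ≡ strong
  label-strong i j refl = labelCell-strong (dominated? (rowPos (toℕ j)) (phase (toℕ j)) i)

  strongNeighbour : ∀ v → label v ≡ empty → StrongNeighbour grid label v
  strongNeighbour (i , j) e =
    from-dominated j (labelCell-empty (strongCell (phase (toℕ j)) i)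
                                      (dominated? (rowPos (toℕ j)) (phase (toℕ j)) i) e)
    where
    from-dominated : ∀ j → Dominated (rowPos (toℕ j)) (phase (toℕ j)) i →
                     StrongNeighbour grid label (i , j)
    from-dominated j (inj₁ (i′ , ii′ , s)) =
      (i′ , j) , ∈-grid _ , adj-row i i′ j ii′ , label-strong i′ j refl s
    from-dominated Fin.zero (inj₂ (inj₁ (() , _)))
    from-dominated (Fin.suc j) (inj₂ (inj₁ (_ , s))) =
      (i , inject₁ j) , ∈-grid _ ,
      adj-column i (Fin.suc j) (inject₁ j) (pathAdj-pred _ _ (cong suc (sym (toℕ-inject₁ j)))) ,
      label-strong i (inject₁ j) (toℕ-inject₁ j)
        (subst (λ p → T (strongCell p i)) (prev-next (phase (toℕ j))) s)
    from-dominated j (inj₂ (inj₂ (below , s))) =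
      (i , j₊) , ∈-grid _ , adj-column i j j₊ (pathAdj-suc j j₊ (toℕ-fromℕ< j<)) ,
      label-strong i j₊ (toℕ-fromℕ< j<) s
      where
      j< = hasBelow⇒suc< (toℕ j) (toℕ<n j) below
      j₊ = fromℕ< j<

  undominated-row : ∀ x → undominatedInRow (rowPos x) (phase x) ≡ boundary (rowPos x)
  undominated-row zero = undominated-top (suc m)
  undominated-row (suc x) with x ≡ᵇ m in x=m
  ... | true  rewrite ≡ᵇ⇒≡ x m (from T-≡ x=m) = undominated-bottom (suc m)
  ... | false = undominated-middle (phase (suc x))

  strongCount : ∑[ j < suc (suc m) ] ∑[ i < 9 ] #strong (label (i , j)) ≡ suc (suc m) * 2
  strongCount =
    trans (sum-cong-≗ {suc (suc m)} (λ j → strongInRow (rowPos (toℕ j)) (phase (toℕ j))))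
          (∑-const (suc (suc m)) 2)

  undominatedCount : ∑[ j < suc (suc m) ] ∑[ i < 9 ] #weak (label (i , j)) ≡ 2
  undominatedCount = begin
    ∑[ j < suc (suc m) ] undominatedInRow (rowPos (toℕ j)) (phase (toℕ j))
      ≡⟨ sum-cong-≗ {suc (suc m)} (undominated-row ∘ toℕ) ⟩
    ∑[ j < suc (suc m) ] boundary (rowPos (toℕ j))
      ≡⟨ cong (1 +_) (sum-cong-≗ {suc m} (λ j → if-float boundary (toℕ j ≡ᵇ m) {bottom} {middle})) ⟩
    1 + ∑[ j < suc m ] (if toℕ j ≡ᵇ m then 1 else 0)
      ≡⟨ cong (1 +_) (∑-indicator-last m) ⟩
    2 ∎
    where open ≡-Reasoning

  weight-label : ∀ k → weight grid (value k ∘ label) ≡ 2 * suc (suc m) * (k + 1) + 2 * k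
  weight-label k = begin
    weight grid (value k ∘ label)
      ≡⟨ sum-map-value k label (verts grid) ⟩
    count #strong * suc k + count #weak * k
      ≡⟨ cong₂ (λ s w → s * suc k + w * k)
               (trans (sum-map-grid (#strong ∘ label)) strongCount)
               (trans (sum-map-grid (#weak ∘ label)) undominatedCount) ⟩
    suc (suc m) * 2 * suc k + 2 * k
      ≡⟨ rearrange (suc (suc m)) k ⟩
    2 * suc (suc m) * (k + 1) + 2 * k ∎
    where
    open ≡-Reasoning
    count : (Label → ℕ) → ℕ
    count c = sum (map (c ∘ label) (verts grid))
    rearrange : ∀ n k → n * 2 * suc k + 2 * k ≡ 2 * n * (k + 1) + 2 * k
    rearrange = solve-∀

theorem1 : (k n : ℕ) → 1 ≤ k → 2 ≤ n → γ[ k ]R≤ (CP 9 n) (2 * n * (k + 1) + 2 * k)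
-- The construction works for every k, including k = 0.
theorem1 k (suc (suc m)) _ (s≤s (s≤s z≤n)) =
  value k ∘ label , isKRDF-value label strongNeighbour , ≤-reflexive (weight-label k)
  where open Grid m
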